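{- Let $G$ be an amenable graph, $A_i$ an anisotropic component of $C(G)$ with root $R_i$, $G_i=G[\bigcup_{X\in A_i}X]$, and let $J_i$ be the graph obtained from $G_i$ by the modifications (M1), (M2), (M3). Then $Aut(G_i,\mathcal{P}_G)=Aut(J_i,\mathcal{P}_G)$, and consequently $D(G_i,\mathcal{P}_G)=D(J_i,\mathcal{P}_G)$.
   Context: Color refinement on a graph $K$: start with $\mathcal{P}_0=\{V(K)\}$; given $\mathcal{P}_{i-1}$, two vertices lie in the same cell of $\mathcal{P}_i$ iff they lie in the same cell of $\mathcal{P}_{i-1}$ and have the same number of neighbors in every cell of $\mathcal{P}_{i-1}$; stop when stable; for $K=G$ the result is the stable partition $\mathcal{P}_G$. $G$ is amenable if, for every graph $H$, running color refinement on $G\cup H$ and declaring $G\cong H$ iff each final cell contains equally many vertices of $G$ and $H$ gives the correct answer. The cell graph $C(G)$ is the complete graph on $\mathcal{P}_G$. A cell $X$ is homogeneous if $G[X]$ is empty or complete, heterogeneous otherwise. A pair of distinct cells $X,Y$ is isotropic if the bipartite graph $G[X,Y]$ between them is empty or complete bipartite, anisotropic otherwise; anisotropic components are the connected components of the graph on $\mathcal{P}_G$ formed by the anisotropic pairs. Known facts for amenable $G$ (Arvind et al.): each $G[X]$ is a 5-cycle, empty, complete, a matching graph $rK_2$ ($r\ge2$) or its complement; each $G[X,Y]$ is empty, complete bipartite, a disjoint union of stars $sK_{1,t}$ with centers on one side, or the bipartite complement of such; each anisotropic component is a tree with at most one heterogeneous cell, which has least cardinality in the component. The root $R_i$ of $A_i$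 is its heterogeneous cell if one exists, otherwise a cell of least cardinality in $A_i$. Modifications applied to $G_i$: (M1) if $G_i[R_i]$ is a matching graph or empty, replace it by its complement; (M2) for every other cell $X$ of $A_i$, if $G_i[X]$ is complete, replace it by its complement; (M3) for each pair of distinct cells $X,Y$ of $A_i$: if $XY$ is isotropic and $G_i[X,Y]$ is complete bipartite, replace it by the empty bipartite graph; if $XY$ is anisotropic and $G_i[X,Y]$ is the bipartite complement of $sK_{1,t}$, replace it by $sK_{1,t}$. For a graph $F$ with $V(F)\subseteq V(G)$, $Aut(F,\mathcal{P}_G)$ is the set of automorphisms of $F$ mapping each vertex into its own cell of $\mathcal{P}_G$; a labeling of $F$ is $\mathcal{P}_G$-distinguishing if the only label-preserving element of $Aut(F,\mathcal{P}_G)$ is the identity; $D(F,\mathcal{P}_G)$ is the fewest colors of such a labeling. -}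

module Defs where

open import Data.Nat using (ℕ; zero; suc; _+_; _≤_; _<_; _≡ᵇ_)
open import Data.Bool using (Bool; true; false; _∧_; not; if_then_else_)
open import Data.Fin using (Fin; zero; suc; splitAt; _↑ˡ_; _↑ʳ_)
open import Data.Sum using (_⊎_; inj₁; inj₂)
open import Data.Product using (Σ; _×_; _,_)
open import Data.Empty using (⊥)
open import Relation.Nullary using (¬_)
open import Relation.Binary.PropositionalEquality using (_≡_; _≢_; refl)
open import Relation.Binary.Construct.Closure.ReflexiveTransitive using (Star)
open import Function.Bundles using (_⇔_)
open import Function.Definitions using (Bijective; Injective)

record Graph (n : ℕ) : Set where
  field
    adj    : Fin n → Fin n → Bool
    sym    : ∀ u v → adj u v ≡ adj v u
    irrefl : ∀ v → adj v v ≡ false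

open Graph public

count : ∀ {n} → (Fin n → Bool) → ℕ
count {zero}  p = 0
count {suc n} p = (if p zero then 1 else 0) + count (λ i → p (suc i))

allF : ∀ {n} → (Fin n → Bool) → Bool
allF {zero}  p = true
allF {suc n} p = p zero ∧ allF (λ i → p (suc i))

-- Color refinement.  refine K i x y = true  iff  x, y lie in the same
-- cell of P_i.  (Cells of P_i are the classes of the vertices z, so
-- "same number of neighbours in every cell of P_{i-1}" quantifies over z.)

refine : ∀ {n} → Graph n → ℕ → Fin n → Fin n → Bool
refine K zero    x y = true
refine K (suc i) x y =
  refine K i x y ∧
  allF (λ z → count (λ w → adj K x w ∧ refine K i w z)
           ≡ᵇ count (λ w → adj K y w ∧ refine K i w z))

-- The stable partition: the partition of a graph on n vertices can be
-- strictly refined at most n - 1 times, and once P_i = P_{i+1} all later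
-- rounds coincide, so after n rounds color refinement has stopped.
stablePart : ∀ {n} → Graph n → Fin n → Fin n → Bool
stablePart {n} K = refine K n

module _ {n m : ℕ} (G : Graph n) (H : Graph m) where

  uadj : Fin n ⊎ Fin m → Fin n ⊎ Fin m → Bool
  uadj (inj₁ a) (inj₁ b) = adj G a b
  uadj (inj₂ a) (inj₂ b) = adj H a b
  uadj (inj₁ _) (inj₂ _) = false
  uadj (inj₂ _) (inj₁ _) = false

  uadj-sym : ∀ s t → uadj s t ≡ uadj t s
  uadj-sym (inj₁ a) (inj₁ b) = sym G a b
  uadj-sym (inj₂ a) (inj₂ b) = sym H a b
  uadj-sym (inj₁ _) (inj₂ _) = refl
  uadj-sym (inj₂ _) (inj₁ _) = refl

  uadj-irr : ∀ s → uadj s s ≡ false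
  uadj-irr (inj₁ a) = irrefl G a
  uadj-irr (inj₂ a) = irrefl H a

  -- G ∪ H on Fin (n + m): G-vertices are x ↑ˡ m, H-vertices n ↑ʳ y
  _⊕_ : Graph (n + m)
  _⊕_ = record
    { adj    = λ u v → uadj (splitAt n u) (splitAt n v)
    ; sym    = λ u v → uadj-sym (splitAt n u) (splitAt n v)
    ; irrefl = λ u → uadj-irr (splitAt n u)
    }

  Iso : Set
  Iso = Σ (Fin n → Fin m) λ f →
          Bijective _≡_ _≡_ f × (∀ u v → adj H (f u) (f v) ≡ adj G u v)

  CRSaysIso : Set
  CRSaysIso = ∀ (z : Fin (n + m)) →
    count (λ x → stablePart _⊕_ (x ↑ˡ m) z) ≡ count (λ y → stablePart _⊕_ (n ↑ʳ y) z)

Amenable : ∀ {n} → Graph n → Set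
Amenable {n} G = ∀ (m : ℕ) (H : Graph m) → Iso G H ⇔ CRSaysIso G H

-- Subgraphs F with V(F) ⊆ V(G), given by a vertex predicate and an
-- adjacency relation (only its values on V(F) matter).

record SubG (n : ℕ) : Set₁ where
  field
    V : Fin n → Set
    E : Fin n → Fin n → Set

open SubG public

module _ {n : ℕ} (G : Graph n) where

  Same : Fin n → Fin n → Set
  Same x y = stablePart G x y ≡ true

  Adj : Fin n → Fin n → Set
  Adj u v = adj G u v ≡ true

  cellSize : Fin n → ℕ
  cellSize x = count (λ v → stablePart G x v)

  -- cells are named by a representative vertex x (the cell X = [x])
  EmptyCell : Fin n → Set
  EmptyCell x = ∀ u v → Same x u → Same x v → ¬ Adj u v

  CompleteCell : Fin n → Set
  CompleteCell x = ∀ u v → Same x u → Same x v → u ≢ v → Adj u v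

  Heterogeneous : Fin n → Set
  Heterogeneous x = ¬ EmptyCell x × ¬ CompleteCell x

  -- G[X] is a matching graph r K₂ with r ≥ 2
  MatchingCell : Fin n → Set
  MatchingCell x =
    (∀ u → Same x u → count (λ w → adj G u w ∧ stablePart G x w) ≡ 1) × (4 ≤ cellSize x)

  EmptyPair : Fin n → Fin n → Set
  EmptyPair x y = ∀ u v → Same x u → Same y v → ¬ Adj u v

  CompletePair : Fin n → Fin n → Set
  CompletePair x y = ∀ u v → Same x u → Same y v → Adj u v

  Isotropic : Fin n → Fin n → Set
  Isotropic x y = ¬ Same x y × (EmptyPair x y ⊎ CompletePair x y)

  Anisotropic : Fin n → Fin n → Set
  Anisotropic x y = ¬ Same x y × ¬ EmptyPair x y × ¬ CompletePair x y

  -- G[X,Y] is the bipartite complement of s K_{1,t}, centres in X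
  -- (in the bipartite complement every vertex of Y has exactly one
  -- neighbour in X) or centres in Y.
  ComplStarsCentresIn : Fin n → Fin n → Set
  ComplStarsCentresIn x y =
    ∀ v → Same y v → count (λ u → not (adj G u v) ∧ stablePart G x u) ≡ 1

  ComplStarForest : Fin n → Fin n → Set
  ComplStarForest x y = ComplStarsCentresIn x y ⊎ ComplStarsCentresIn y x

  SameComp : Fin n → Fin n → Set
  SameComp = Star (λ x y → Same x y ⊎ Anisotropic x y)

  IsRoot : Fin n → Fin n → Set
  IsRoot a r =
    SameComp a r ×
    (Heterogeneous r ⊎
      ((∀ v → SameComp a v → ¬ Heterogeneous v) ×
       (∀ v → SameComp a v → cellSize r ≤ cellSize v)))

  Gi : Fin n → SubG n
  Gi a = record { V = SameComp a ; E = Adj }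

  MatchOrEmpty : Fin n → Set
  MatchOrEmpty x = MatchingCell x ⊎ EmptyCell x

  JAdj : Fin n → Fin n → Fin n → Fin n → Set
  JAdj a r u v = SameComp a u × SameComp a v ×
    ( -- (M1) root cell
      (Same u v × Same r u × MatchOrEmpty r × u ≢ v × ¬ Adj u v)
    ⊎ (Same u v × Same r u × ¬ MatchOrEmpty r × Adj u v)
      -- (M2) other cells
    ⊎ (Same u v × ¬ Same r u × CompleteCell u × u ≢ v × ¬ Adj u v)
    ⊎ (Same u v × ¬ Same r u × ¬ CompleteCell u × Adj u v)
      -- (M3) pairs of distinct cells
    ⊎ (Isotropic u v × CompletePair u v × ⊥)
    ⊎ (Isotropic u v × ¬ CompletePair u v × Adj u v)
    ⊎ (Anisotropic u v × ComplStarForest u v × ¬ Adj u v)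
    ⊎ (Anisotropic u v × ¬ ComplStarForest u v × Adj u v))

  Ji : Fin n → Fin n → SubG n
  Ji a r = record { V = SameComp a ; E = JAdj a r }

  -- σ (extended by the identity outside V(F)) is in Aut(F, P_G)
  IsAut : SubG n → (Fin n → Fin n) → Set
  IsAut F σ =
    Injective _≡_ _≡_ σ ×
    (∀ v → ¬ V F v → σ v ≡ v) ×
    (∀ v → V F v → V F (σ v)) ×
    (∀ v → V F v → Same v (σ v)) ×
    (∀ u v → V F u → V F v → (E F u v ⇔ E F (σ u) (σ v)))

  Distinguishing : (F : SubG n) {k : ℕ} → (Fin n → Fin k) → Set
  Distinguishing F ℓ =
    ∀ σ → IsAut F σ → (∀ v → V F v → ℓ (σ v) ≡ ℓ v) → ∀ v → σ v ≡ v

  IsDistNumber : SubG n → ℕ → Set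
  IsDistNumber F k =
    Σ (Fin n → Fin k) (Distinguishing F) ×
    (∀ j → j < k → ¬ Σ (Fin n → Fin j) (Distinguishing F))

-- Each of (M1)–(M3) complements the adjacency of G_i on a set of vertex pairs that is a
-- union of products X × Y of cells of P_G. A map that sends every vertex into its own cell
-- preserves this set of pairs, and an injective one also preserves distinctness; so it
-- preserves the adjacency of G_i if and only if it preserves that of J_i. Hence G_i and J_i,
-- which have the same vertex set, have the same P_G-automorphisms and therefore the same
-- P_G-distinguishing labelings.

module Submission where

open import Defs
open import Data.Bool using (Bool; true; false; _∧_; not; if_then_else_)
import Data.Bool.Properties as Bool
open import Data.Empty using (⊥-elim)
open import Data.Fin using (Fin; zero; suc)
import Data.Fin.Properties as Fin
open import Data.Nat using (ℕ; zero; suc; _+_; _≡ᵇ_)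
import Data.Nat.Properties as ℕ
open import Data.Product using (_×_; _,_; proj₁; proj₂)
open import Data.Sum using (_⊎_; inj₁; inj₂; [_,_]; map)
open import Function using (_∘_)
open import Function.Bundles using (_⇔_; mk⇔; Equivalence)
open import Function.Definitions using (Injective)
import Function.Properties.Equivalence as ⇔
open import Function.Related.TypeIsomorphisms using (¬-cong-⇔)
open import Relation.Binary.Structures using (IsEquivalence)
open import Relation.Binary.PropositionalEquality
  using (_≡_; _≢_; refl; cong; cong₂)
  renaming (sym to ≡-sym; trans to ≡-trans)
open import Relation.Nullary using (¬_; Dec; yes; no)
open import Relation.Nullary.Decidable using (¬?; _×-dec_; _⊎-dec_; _→-dec_)
open import Relation.Unary using (_≐_)
open import Relation.Unary.Properties using (≐-refl)

open Equivalence using (to; from)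

∧≡true⇔ : ∀ {x y : Bool} → x ∧ y ≡ true ⇔ (x ≡ true × y ≡ true)
∧≡true⇔ {true}  = mk⇔ (refl ,_) proj₂
∧≡true⇔ {false} = mk⇔ (λ ()) (λ ())

allF≡true⇔ : ∀ {n} {p : Fin n → Bool} → allF p ≡ true ⇔ (∀ i → p i ≡ true)
allF≡true⇔ {zero}  = mk⇔ (λ _ ()) (λ _ → refl)
allF≡true⇔ {suc n} = mk⇔
  (λ h → let (p₀ , ps) = to ∧≡true⇔ h in λ where
    zero    → p₀
    (suc i) → to allF≡true⇔ ps i)
  (λ h → from ∧≡true⇔ (h zero , from allF≡true⇔ (h ∘ suc)))

≡ᵇ≡true⇔ : ∀ {m k} → (m ≡ᵇ k) ≡ true ⇔ m ≡ k
≡ᵇ≡true⇔ {m} {k} = mk⇔ (ℕ.≡ᵇ⇒≡ m k ∘ from Bool.T-≡) (to Bool.T-≡ ∘ ℕ.≡⇒≡ᵇ m k)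

count-cong : ∀ {n} {p q : Fin n → Bool} → (∀ i → p i ≡ q i) → count p ≡ count q
count-cong {zero}  _   = refl
count-cong {suc n} p≗q =
  cong₂ _+_ (cong (λ b → if b then 1 else 0) (p≗q zero)) (count-cong (p≗q ∘ suc))

module _ {A F : Set} where

  ⇔¬-of-both : ¬ A → F → A ⇔ (¬ F)
  ⇔¬-of-both ¬a f = mk⇔ (⊥-elim ∘ ¬a) (λ ¬f → ⊥-elim (¬f f))

  ⇔¬-of-neither : A → ¬ F → A ⇔ (¬ F)
  ⇔¬-of-neither a ¬f = mk⇔ (λ _ → ¬f) (λ _ → a)

module _ {D D′ A A′ F F′ : Set} where

  toggle-transport : (D → D′) → (F ⇔ F′) → (A ⇔ A′) → D × (A ⇔ (¬ F)) → D′ × (A′ ⇔ (¬ F′))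
  toggle-transport D→D′ F⇔F′ A⇔A′ (d , A⇔¬F) =
    D→D′ d , ⇔.trans (⇔.sym A⇔A′) (⇔.trans A⇔¬F (¬-cong-⇔ F⇔F′))

  toggle-cancel : Dec F → Dec A′ → (F ⇔ F′) → (A → D) → (D → D′) →
    ((D × (A ⇔ (¬ F))) ⇔ (D′ × (A′ ⇔ (¬ F′)))) → A → A′
  toggle-cancel _       (yes a′) _    _    _     _    _ = a′
  toggle-cancel (yes f) (no ¬a′) F⇔F′ A→D D→D′ T⇔T′ a =
    ⊥-elim (to (proj₂ (from T⇔T′ (D→D′ (A→D a) , ⇔¬-of-both ¬a′ (to F⇔F′ f)))) a f)
    
  toggle-cancel (no ¬f) (no _)   F⇔F′ A→D _ T⇔T′ a =
    from (proj₂ (to T⇔T′ (A→D a , ⇔¬-of-neither a ¬f))) (¬f ∘ from F⇔F′)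

module _ {n : ℕ} (K : Graph n) where

  private
    neighboursIn : ℕ → Fin n → Fin n → ℕ
    neighboursIn i x z = count (λ w → adj K x w ∧ refine K i w z)

  refine-suc⇔ : ∀ i {x y} → refine K (suc i) x y ≡ true ⇔
    (refine K i x y ≡ true × (∀ z → neighboursIn i x z ≡ neighboursIn i y z))
  refine-suc⇔ _ = mk⇔
    (λ h → let (same , counts) = to ∧≡true⇔ h in
       same , λ z → to ≡ᵇ≡true⇔ (to allF≡true⇔ counts z))
    (λ (same , counts) → from ∧≡true⇔ (same , from allF≡true⇔ (from ≡ᵇ≡true⇔ ∘ counts)))

  refine-isEquivalence : ∀ i → IsEquivalence (λ x y → refine K i x y ≡ true)
  refine-isEquivalence zero = record
    { refl = refl ; sym = λ _ → refl ; trans = λ _ _ → refl }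
  refine-isEquivalence (suc i) = record
    { refl  = from (refine-suc⇔ i) (E.refl , λ _ → refl)
    ; sym   = λ xy → let (s , c) = to (refine-suc⇔ i) xy in
                from (refine-suc⇔ i) (E.sym s , ≡-sym ∘ c)
    ; trans = λ xy yz → let (s , c) = to (refine-suc⇔ i) xy ; (s′ , c′) = to (refine-suc⇔ i) yz in
                from (refine-suc⇔ i) (E.trans s s′ , λ z → ≡-trans (c z) (c′ z))
    }
    where module E = IsEquivalence (refine-isEquivalence i)

module _ {n : ℕ} (G : Graph n) where

  open IsEquivalence (refine-isEquivalence G n) public
    renaming (refl to Same-refl; sym to Same-sym; trans to Same-trans)

  stablePart-cong : ∀ {x x′} → Same G x x′ → ∀ w → stablePart G x w ≡ stablePart G x′ w
  stablePart-cong xx′ w = Bool.⇔→≡ (mk⇔ (Same-trans (Same-sym xx′)) (Same-trans xx′))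

  Same-resp : ∀ {x x′ y y′} → Same G x x′ → Same G y y′ → Same G x y → Same G x′ y′
  Same-resp xx′ yy′ xy = Same-trans (Same-sym xx′) (Same-trans xy yy′)

  CompleteCell-resp : ∀ {x x′} → Same G x x′ → CompleteCell G x → CompleteCell G x′
  CompleteCell-resp xx′ c u v x′u x′v = c u v (Same-trans xx′ x′u) (Same-trans xx′ x′v)

  EmptyPair-resp : ∀ {x x′ y y′} → Same G x x′ → Same G y y′ → EmptyPair G x y → EmptyPair G x′ y′
  EmptyPair-resp xx′ yy′ e u v x′u y′v = e u v (Same-trans xx′ x′u) (Same-trans yy′ y′v)

  CompletePair-resp : ∀ {x x′ y y′} → Same G x x′ → Same G y y′ → CompletePair G x y → CompletePair G x′ y′
  CompletePair-resp xx′ yy′ c u v x′u y′v = c u v (Same-trans xx′ x′u) (Same-trans yy′ y′v)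

  ComplStarsCentresIn-resp : ∀ {x x′ y y′} → Same G x x′ → Same G y y′ →
    ComplStarsCentresIn G x y → ComplStarsCentresIn G x′ y′
  ComplStarsCentresIn-resp xx′ yy′ c v y′v =
    ≡-trans (count-cong λ u → cong (_ ∧_) (≡-sym (stablePart-cong xx′ u))) (c v (Same-trans yy′ y′v))

  ComplStarForest-resp : ∀ {x x′ y y′} → Same G x x′ → Same G y y′ →
    ComplStarForest G x y → ComplStarForest G x′ y′
  ComplStarForest-resp xx′ yy′ (inj₁ c) = inj₁ (ComplStarsCentresIn-resp xx′ yy′ c)
  ComplStarForest-resp xx′ yy′ (inj₂ c) = inj₂ (ComplStarsCentresIn-resp yy′ xx′ c)

  Isotropic-resp : ∀ {x x′ y y′} → Same G x x′ → Same G y y′ → Isotropic G x y → Isotropic G x′ y′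
  Isotropic-resp xx′ yy′ (x≁y , e⊎c) =
    x≁y ∘ Same-resp (Same-sym xx′) (Same-sym yy′) ,
    map (EmptyPair-resp xx′ yy′) (CompletePair-resp xx′ yy′) e⊎c

  Anisotropic-resp : ∀ {x x′ y y′} → Same G x x′ → Same G y y′ → Anisotropic G x y → Anisotropic G x′ y′
  Anisotropic-resp xx′ yy′ (x≁y , ¬e , ¬c) =
    x≁y ∘ Same-resp x′x y′y , ¬e ∘ EmptyPair-resp x′x y′y , ¬c ∘ CompletePair-resp x′x y′y
    where x′x = Same-sym xx′ ; y′y = Same-sym yy′

  Adj⇒≢ : ∀ {u v} → Adj G u v → u ≢ v
  Adj⇒≢ {u} uv refl with ≡-trans (≡-sym uv) (irrefl G u)
  ... | ()

  Same? : ∀ x y → Dec (Same G x y)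
  Same? x y = stablePart G x y Bool.≟ true

  Adj? : ∀ u v → Dec (Adj G u v)
  Adj? u v = adj G u v Bool.≟ true

  EmptyCell? : ∀ x → Dec (EmptyCell G x)
  EmptyCell? x = Fin.all? λ u → Fin.all? λ v → Same? x u →-dec Same? x v →-dec ¬? (Adj? u v)

  CompleteCell? : ∀ x → Dec (CompleteCell G x)
  CompleteCell? x = Fin.all? λ u → Fin.all? λ v →
    Same? x u →-dec Same? x v →-dec ¬? (u Fin.≟ v) →-dec Adj? u v

  MatchingCell? : ∀ x → Dec (MatchingCell G x)
  MatchingCell? x =
    (Fin.all? λ u → Same? x u →-dec count (λ w → adj G u w ∧ stablePart G x w) ℕ.≟ 1)
    ×-dec 4 ℕ.≤? cellSize G x

  MatchOrEmpty? : ∀ x → Dec (MatchOrEmpty G x)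
  MatchOrEmpty? x = MatchingCell? x ⊎-dec EmptyCell? x

  EmptyPair? : ∀ x y → Dec (EmptyPair G x y)
  EmptyPair? x y = Fin.all? λ u → Fin.all? λ v → Same? x u →-dec Same? y v →-dec ¬? (Adj? u v)

  CompletePair? : ∀ x y → Dec (CompletePair G x y)
  CompletePair? x y = Fin.all? λ u → Fin.all? λ v → Same? x u →-dec Same? y v →-dec Adj? u v

  ComplStarsCentresIn? : ∀ x y → Dec (ComplStarsCentresIn G x y)
  ComplStarsCentresIn? x y = Fin.all? λ v → Same? y v →-dec
    count (λ u → not (adj G u v) ∧ stablePart G x u) ℕ.≟ 1

  ComplStarForest? : ∀ x y → Dec (ComplStarForest G x y)
  ComplStarForest? x y = ComplStarsCentresIn? x y ⊎-dec ComplStarsCentresIn? y x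

  Isotropic? : ∀ x y → Dec (Isotropic G x y)
  Isotropic? x y = ¬? (Same? x y) ×-dec (EmptyPair? x y ⊎-dec CompletePair? x y)

  Anisotropic? : ∀ x y → Dec (Anisotropic G x y)
  Anisotropic? x y = ¬? (Same? x y) ×-dec ¬? (EmptyPair? x y) ×-dec ¬? (CompletePair? x y)

module _ {n : ℕ} (G : Graph n) (r : Fin n) where

  Flipped : Fin n → Fin n → Set
  Flipped u v = (Same G u v × Same G r u × MatchOrEmpty G r)
              ⊎ (Same G u v × ¬ Same G r u × CompleteCell G u)
              ⊎ (Isotropic G u v × CompletePair G u v)
              ⊎ (Anisotropic G u v × ComplStarForest G u v)

  Flipped? : ∀ u v → Dec (Flipped u v)
  Flipped? u v = (Same? G u v ×-dec Same? G r u ×-dec MatchOrEmpty? G r)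
            ⊎-dec (Same? G u v ×-dec ¬? (Same? G r u) ×-dec CompleteCell? G u)
            ⊎-dec (Isotropic? G u v ×-dec CompletePair? G u v)
            ⊎-dec (Anisotropic? G u v ×-dec ComplStarForest? G u v)

  Flipped-resp : ∀ {u u′ v v′} → Same G u u′ → Same G v v′ → Flipped u v → Flipped u′ v′
  Flipped-resp uu′ vv′ (inj₁ (uv , ru , m)) =
    inj₁ (Same-resp G uu′ vv′ uv , Same-trans G ru uu′ , m)
  Flipped-resp uu′ vv′ (inj₂ (inj₁ (uv , r≁u , c))) =
    inj₂ (inj₁ (Same-resp G uu′ vv′ uv , (λ ru′ → r≁u (Same-trans G ru′ (Same-sym G uu′))) ,
                CompleteCell-resp G uu′ c))
  Flipped-resp uu′ vv′ (inj₂ (inj₂ (inj₁ (i , c)))) =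
    inj₂ (inj₂ (inj₁ (Isotropic-resp G uu′ vv′ i , CompletePair-resp G uu′ vv′ c)))
  Flipped-resp uu′ vv′ (inj₂ (inj₂ (inj₂ (an , c)))) =
    inj₂ (inj₂ (inj₂ (Anisotropic-resp G uu′ vv′ an , ComplStarForest-resp G uu′ vv′ c)))

  -- Off the diagonal, J_i is G_i with the adjacency complemented exactly on the flipped pairs.
  Toggled : Fin n → Fin n → Set
  Toggled u v = u ≢ v × (Adj G u v ⇔ (¬ Flipped u v))

  rootCell-unflipped : ∀ {u v} → Same G u v → Same G r u → ¬ MatchOrEmpty G r → ¬ Flipped u v
  rootCell-unflipped _  _  ¬m (inj₁ (_ , _ , m))                   = ¬m m
  rootCell-unflipped _  ru _  (inj₂ (inj₁ (_ , r≁u , _)))          = r≁u ru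
  rootCell-unflipped uv _  _  (inj₂ (inj₂ (inj₁ ((u≁v , _) , _)))) = u≁v uv
  rootCell-unflipped uv _  _  (inj₂ (inj₂ (inj₂ ((u≁v , _) , _)))) = u≁v uv

  otherCell-unflipped : ∀ {u v} → Same G u v → ¬ Same G r u → ¬ CompleteCell G u → ¬ Flipped u v
  otherCell-unflipped _  r≁u _  (inj₁ (_ , ru , _))                  = r≁u ru
  otherCell-unflipped _  _   ¬c (inj₂ (inj₁ (_ , _ , c)))            = ¬c c
  otherCell-unflipped uv _   _  (inj₂ (inj₂ (inj₁ ((u≁v , _) , _)))) = u≁v uv
  otherCell-unflipped uv _   _  (inj₂ (inj₂ (inj₂ ((u≁v , _) , _)))) = u≁v uv

  isotropic-unflipped : ∀ {u v} → Isotropic G u v → ¬ CompletePair G u v → ¬ Flipped u v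
  isotropic-unflipped (u≁v , _)    _  (inj₁ (uv , _))                            = u≁v uv
  isotropic-unflipped (u≁v , _)    _  (inj₂ (inj₁ (uv , _)))                     = u≁v uv
  isotropic-unflipped _            ¬c (inj₂ (inj₂ (inj₁ (_ , c))))               = ¬c c
  isotropic-unflipped (_ , inj₁ e) _  (inj₂ (inj₂ (inj₂ ((_ , ¬e , _) , _)))) = ¬e e
  isotropic-unflipped (_ , inj₂ c) _  (inj₂ (inj₂ (inj₂ ((_ , _ , ¬c) , _)))) = ¬c c

  anisotropic-unflipped : ∀ {u v} → Anisotropic G u v → ¬ ComplStarForest G u v → ¬ Flipped u v
  anisotropic-unflipped (u≁v , _)     _  (inj₁ (uv , _))                      = u≁v uv
  anisotropic-unflipped (u≁v , _)     _  (inj₂ (inj₁ (uv , _)))               = u≁v uv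
  anisotropic-unflipped (_ , ¬e , ¬c) _  (inj₂ (inj₂ (inj₁ ((_ , e⊎c) , _)))) = [ ¬e , ¬c ] e⊎c
  anisotropic-unflipped _             ¬f (inj₂ (inj₂ (inj₂ (_ , f))))         = ¬f f

module _ {n : ℕ} (G : Graph n) (a r : Fin n) where

  JAdj⇒Toggled : ∀ {u v} → JAdj G a r u v → Toggled G r u v
  JAdj⇒Toggled (_ , _ , inj₁ (uv , ru , m , u≢v , ¬uv)) =
    u≢v , ⇔¬-of-both ¬uv (inj₁ (uv , ru , m))
  JAdj⇒Toggled (_ , _ , inj₂ (inj₁ (uv , ru , ¬m , adj))) =
    Adj⇒≢ G adj , ⇔¬-of-neither adj (rootCell-unflipped G r uv ru ¬m)
  JAdj⇒Toggled (_ , _ , inj₂ (inj₂ (inj₁ (uv , r≁u , c , u≢v , ¬uv)))) =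
    u≢v , ⇔¬-of-both ¬uv (inj₂ (inj₁ (uv , r≁u , c)))
  JAdj⇒Toggled (_ , _ , inj₂ (inj₂ (inj₂ (inj₁ (uv , r≁u , ¬c , adj))))) =
    Adj⇒≢ G adj , ⇔¬-of-neither adj (otherCell-unflipped G r uv r≁u ¬c)
  JAdj⇒Toggled (_ , _ , inj₂ (inj₂ (inj₂ (inj₂ (inj₁ (_ , _ , ()))))))
  JAdj⇒Toggled (_ , _ , inj₂ (inj₂ (inj₂ (inj₂ (inj₂ (inj₁ (i , ¬c , adj))))))) =
    Adj⇒≢ G adj , ⇔¬-of-neither adj (isotropic-unflipped G r i ¬c)
  JAdj⇒Toggled (_ , _ , inj₂ (inj₂ (inj₂ (inj₂ (inj₂ (inj₂ (inj₁ (an , f , ¬uv)))))))) =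
    (λ { refl → proj₁ an (Same-refl G) }) , ⇔¬-of-both ¬uv (inj₂ (inj₂ (inj₂ (an , f))))
  JAdj⇒Toggled (_ , _ , inj₂ (inj₂ (inj₂ (inj₂ (inj₂ (inj₂ (inj₂ (an , ¬f , adj)))))))) =
    Adj⇒≢ G adj , ⇔¬-of-neither adj (anisotropic-unflipped G r an ¬f)

  flipped⇒JAdj : ∀ {u v} → SameComp G a u → SameComp G a v → u ≢ v → ¬ Adj G u v →
    Flipped G r u v → JAdj G a r u v
  flipped⇒JAdj cu cv u≢v ¬uv (inj₁ (uv , ru , m)) =
    cu , cv , inj₁ (uv , ru , m , u≢v , ¬uv)
  flipped⇒JAdj cu cv u≢v ¬uv (inj₂ (inj₁ (uv , r≁u , c))) =
    cu , cv , inj₂ (inj₂ (inj₁ (uv , r≁u , c , u≢v , ¬uv)))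
  flipped⇒JAdj {u} {v} _ _ _ ¬uv (inj₂ (inj₂ (inj₁ (_ , c)))) =
    ⊥-elim (¬uv (c u v (Same-refl G) (Same-refl G)))
  flipped⇒JAdj cu cv _ ¬uv (inj₂ (inj₂ (inj₂ (an , f)))) =
    cu , cv , inj₂ (inj₂ (inj₂ (inj₂ (inj₂ (inj₂ (inj₁ (an , f , ¬uv)))))))

  unflipped⇒JAdj : ∀ {u v} → SameComp G a u → SameComp G a v → Adj G u v →
    ¬ Flipped G r u v → JAdj G a r u v
  unflipped⇒JAdj {u} {v} cu cv adj ¬f with Same? G u v
  ... | yes uv with Same? G r u
  ...   | yes ru  = cu , cv , inj₂ (inj₁ (uv , ru , (λ m → ¬f (inj₁ (uv , ru , m))) , adj))
  ...   | no  r≁u = cu , cv , inj₂ (inj₂ (inj₂ (inj₁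
                      (uv , r≁u , (λ c → ¬f (inj₂ (inj₁ (uv , r≁u , c)))) , adj))))
  unflipped⇒JAdj {u} {v} cu cv adj ¬f | no u≁v with CompletePair? G u v | EmptyPair? G u v
  ... | yes c | _    = ⊥-elim (¬f (inj₂ (inj₂ (inj₁ ((u≁v , inj₂ c) , c)))))
  ... | no ¬c | yes e = cu , cv , inj₂ (inj₂ (inj₂ (inj₂ (inj₂ (inj₁ ((u≁v , inj₁ e) , ¬c , adj))))))
  ... | no ¬c | no ¬e = cu , cv , inj₂ (inj₂ (inj₂ (inj₂ (inj₂ (inj₂ (inj₂
                          ((u≁v , ¬e , ¬c) , (λ f → ¬f (inj₂ (inj₂ (inj₂ ((u≁v , ¬e , ¬c) , f))))) , adj)))))))

  Toggled⇒JAdj : ∀ {u v} → SameComp G a u → SameComp G a v → Toggled G r u v → JAdj G a r u v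
  Toggled⇒JAdj {u} {v} cu cv (u≢v , t) with Flipped? G r u v
  ... | yes f  = flipped⇒JAdj cu cv u≢v (λ uv → to t uv f) f
  ... | no ¬f  = unflipped⇒JAdj cu cv (from t ¬f) ¬f

  JAdj⇔Toggled : ∀ {u v} → SameComp G a u → SameComp G a v → JAdj G a r u v ⇔ Toggled G r u v
  JAdj⇔Toggled cu cv = mk⇔ JAdj⇒Toggled (Toggled⇒JAdj cu cv)

module _ {n : ℕ} (G : Graph n) (a r : Fin n) (σ : Fin n → Fin n)
         (σ-injective : Injective _≡_ _≡_ σ)
         (σ-closed : ∀ v → SameComp G a v → SameComp G a (σ v))
         (σ-cells : ∀ v → SameComp G a v → Same G v (σ v)) where

  Preserves : (Fin n → Fin n → Set) → Set
  Preserves E = ∀ u v → SameComp G a u → SameComp G a v → E u v ⇔ E (σ u) (σ v)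

  private
    σ-≢ : ∀ {u v} → u ≢ v → σ u ≢ σ v
    σ-≢ u≢v = u≢v ∘ σ-injective

    σ-≢⁻ : ∀ {u v} → σ u ≢ σ v → u ≢ v
    σ-≢⁻ σu≢σv = σu≢σv ∘ cong σ

  Flipped-preserved : Preserves (Flipped G r)
  Flipped-preserved u v cu cv = mk⇔
    (Flipped-resp G r (σ-cells u cu) (σ-cells v cv))
    (Flipped-resp G r (Same-sym G (σ-cells u cu)) (Same-sym G (σ-cells v cv)))

  Adj-preserved⇒Toggled-preserved : Preserves (Adj G) → Preserves (Toggled G r)
  Adj-preserved⇒Toggled-preserved adj u v cu cv = mk⇔
    (toggle-transport σ-≢  (Flipped-preserved u v cu cv) (adj u v cu cv))
    (toggle-transport σ-≢⁻ (⇔.sym (Flipped-preserved u v cu cv)) (⇔.sym (adj u v cu cv)))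

  JAdj-preserved⇔Toggled-preserved : Preserves (JAdj G a r) ⇔ Preserves (Toggled G r)
  JAdj-preserved⇔Toggled-preserved = mk⇔
    (λ J u v cu cv → ⇔.trans (⇔.sym (JAdj⇔Toggled G a r cu cv)) (⇔.trans (J u v cu cv) (σJAdj⇔Toggled u v cu cv)))
    (λ T u v cu cv → ⇔.trans (JAdj⇔Toggled G a r cu cv) (⇔.trans (T u v cu cv) (⇔.sym (σJAdj⇔Toggled u v cu cv))))
    where
    σJAdj⇔Toggled : ∀ u v → SameComp G a u → SameComp G a v →
      JAdj G a r (σ u) (σ v) ⇔ Toggled G r (σ u) (σ v)
    σJAdj⇔Toggled u v cu cv = JAdj⇔Toggled G a r (σ-closed u cu) (σ-closed v cv)

  Toggled-preserved⇒Adj-preserved : Preserves (Toggled G r) → Preserves (Adj G)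
  Toggled-preserved⇒Adj-preserved T u v cu cv = mk⇔
    (toggle-cancel (Flipped? G r u v) (Adj? G (σ u) (σ v))
       (Flipped-preserved u v cu cv) (Adj⇒≢ G) σ-≢ (T u v cu cv))
    (toggle-cancel (Flipped? G r (σ u) (σ v)) (Adj? G u v)
       (⇔.sym (Flipped-preserved u v cu cv)) (Adj⇒≢ G) σ-≢⁻ (⇔.sym (T u v cu cv)))

  Adj-preserved⇔JAdj-preserved : Preserves (Adj G) ⇔ Preserves (JAdj G a r)
  Adj-preserved⇔JAdj-preserved = mk⇔
    (from JAdj-preserved⇔Toggled-preserved ∘ Adj-preserved⇒Toggled-preserved)
    (Toggled-preserved⇒Adj-preserved ∘ to JAdj-preserved⇔Toggled-preserved)

module _ {n : ℕ} (G : Graph n) {F F′ : SubG n}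
         (Aut⇔ : ∀ σ → IsAut G F σ ⇔ IsAut G F′ σ) (V≐ : V F ≐ V F′) where

  Distinguishing-⇔ : ∀ {k} (ℓ : Fin n → Fin k) → Distinguishing G F ℓ ⇔ Distinguishing G F′ ℓ
  Distinguishing-⇔ ℓ = mk⇔
    (λ d σ σ∈Aut′ ℓσ≡ℓ → d σ (from (Aut⇔ σ) σ∈Aut′) (λ v v∈F → ℓσ≡ℓ v (proj₁ V≐ v∈F)))
    (λ d σ σ∈Aut ℓσ≡ℓ → d σ (to (Aut⇔ σ) σ∈Aut) (λ v v∈F′ → ℓσ≡ℓ v (proj₂ V≐ v∈F′)))

  IsDistNumber-⇔ : ∀ k → IsDistNumber G F k ⇔ IsDistNumber G F′ k
  IsDistNumber-⇔ k = mk⇔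
    (λ ((ℓ , d) , minimal) → (ℓ , to (Distinguishing-⇔ ℓ) d) ,
       λ j j<k (ℓ′ , d′) → minimal j j<k (ℓ′ , from (Distinguishing-⇔ ℓ′) d′))
    (λ ((ℓ , d) , minimal) → (ℓ , from (Distinguishing-⇔ ℓ) d) ,
       λ j j<k (ℓ′ , d′) → minimal j j<k (ℓ′ , to (Distinguishing-⇔ ℓ′) d′))

Aut-Gi⇔Aut-Ji : ∀ {n} (G : Graph n) (a r : Fin n) (σ : Fin n → Fin n) →
  IsAut G (Gi G a) σ ⇔ IsAut G (Ji G a r) σ
Aut-Gi⇔Aut-Ji G a r σ = mk⇔
  (λ (inj , fixed , closed , cells , edges) →
     inj , fixed , closed , cells , to (Adj-preserved⇔JAdj-preserved G a r σ inj closed cells) edges)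
  (λ (inj , fixed , closed , cells , edges) →
     inj , fixed , closed , cells , from (Adj-preserved⇔JAdj-preserved G a r σ inj closed cells) edges)

theorem7 : ∀ {n : ℕ} (G : Graph n) → Amenable G →
    (a r : Fin n) → IsRoot G a r →
    (∀ (σ : Fin n → Fin n) → IsAut G (Gi G a) σ ⇔ IsAut G (Ji G a r) σ) ×
    (∀ (k : ℕ) → IsDistNumber G (Gi G a) k ⇔ IsDistNumber G (Ji G a r) k)
theorem7 G _ a r _ = Aut-Gi⇔Aut-Ji G a r , IsDistNumber-⇔ G (Aut-Gi⇔Aut-Ji G a r) ≐-refl
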